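{- Let $t,k\in\mathbb{N}$. If there exists a $(t+1)$-extremal graph $G$ with $\omega(G)\ge k$, then $s(t+1)\ge s(t)+k$. In particular, $s(t+1)\ge s(t)+2$ for every $t\in\mathbb{N}$.
   Context: All graphs are finite, simple and undirected. $\alpha(G)$ denotes the maximum size of a stable set, $\omega(G)$ the maximum size of a clique, $\theta(G)$ the minimum number of cliques partitioning $V(G)$, and $\mathrm{gap}(G)=\theta(G)-\alpha(G)$. $s(t)$ is the smallest number of vertices of a graph with gap $t$; a graph is $t$-extremal if it has gap $t$ and $s(t)$ vertices. -}

module Defs where

open import Data.Nat using (ℕ; _+_; _≤_)
open import Data.Fin using (Fin)
open import Data.Fin.Subset using (Subset; _∈_; ∣_∣)
open import Data.Product using (Σ; ∃; _×_)
open import Relation.Binary.PropositionalEquality using (_≡_; _≢_)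
open import Relation.Nullary using (¬_)

record Graph (n : ℕ) : Set₁ where
  field
    E     : Fin n → Fin n → Set
    sym   : ∀ {u v} → E u v → E v u
    irrefl : ∀ {u} → ¬ E u u
open Graph public

module _ {n : ℕ} (G : Graph n) where

  IsStable : Subset n → Set
  IsStable S = ∀ u v → u ∈ S → v ∈ S → ¬ E G u v

  IsClique : Subset n → Set
  IsClique S = ∀ u v → u ∈ S → v ∈ S → u ≢ v → E G u v

  IsAlpha : ℕ → Set
  IsAlpha a = (Σ (Subset n) λ S → IsStable S × ∣ S ∣ ≡ a)
            × (∀ S → IsStable S → ∣ S ∣ ≤ a)

  IsOmega : ℕ → Set
  IsOmega w = (Σ (Subset n) λ S → IsClique S × ∣ S ∣ ≡ w)
            × (∀ S → IsClique S → ∣ S ∣ ≤ w)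

  -- a partition of V(G) into (at most) m cliques: vertex v goes to class c v,
  -- each class being a clique (empty classes are allowed, which does not
  -- affect the minimum)
  CliqueCover : ℕ → Set
  CliqueCover m = Σ (Fin n → Fin m) λ c → ∀ u v → c u ≡ c v → u ≢ v → E G u v

  IsTheta : ℕ → Set
  IsTheta m = CliqueCover m × (∀ m' → CliqueCover m' → m ≤ m')

  HasGap : ℕ → Set
  HasGap t = ∃ λ a → ∃ λ θ → IsAlpha a × IsTheta θ × θ ≡ a + t

IsS : ℕ → ℕ → Set₁
IsS t m = (Σ (Graph m) λ G → HasGap G t)
        × (∀ n (G : Graph n) → HasGap G t → m ≤ n)

IsExtremal : ℕ → {n : ℕ} → Graph n → Set₁
IsExtremal t {n} G = HasGap G t × IsS t n

-- Deleting a clique C from a graph G keeps every stable set and costs at most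
-- one clique of a cover, so gap(G ∖ C) ≥ gap(G) − 1.  A smallest graph with
-- gap at least t has gap exactly t, since deleting a single vertex lowers the
-- gap by at most one; hence s(t) ≤ |V(G ∖ C)| = s(t+1) − |C| for a
-- (t+1)-extremal G.  A graph with positive gap has an edge, because an
-- edgeless graph has α = θ = n, so ω ≥ 2.  The numbers α, θ, ω and least
-- elements exist only classically, which is harmless: every conclusion drawn
-- from them is a decidable inequality, recovered with decidable-stable.
module Submission where

open import Defs
open import Data.Nat using (ℕ; suc; _+_; _≤_)
open import Data.Product using (Σ; ∃; _×_)

open import Level using (Level)
open import Data.Nat using (zero; _∸_; _<_; z≤n; s≤s; _≤?_)
open import Data.Nat.Properties
  using (≤-trans; ≤-pred; ≤∧≢⇒<; 1+n≰n; <⇒≱; +-suc; +-monoˡ-≤; +-monoʳ-≤; m∸n+n≡m; m≤m+n; n<1+n; _≟_; module ≤-Reasoning)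
open import Data.Fin using (Fin; zero; suc)
open import Data.Fin.Properties using (suc-injective)
open import Data.Fin.Subset using (Subset; _∈_; ∣_∣; inside; outside; ⊥; ⊤; ∁; ⁅_⁆; _∪_)
open import Data.Fin.Subset.Properties
  using (_∈?_; ∉⊥; ∣p∣≤n; ∣⊥∣≡0; ∣⊤∣≡n; ∣⁅x⁆∣≡1; x∈⁅y⁆⇒x≡y; x∈⁅x⁆; ∣∁p∣≡n∸∣p∣; x∉p⇒x∈∁p;
         x∈p∪q⁻; p⊆p∪q; q⊆p∪q; p⊂q⇒∣p∣<∣q∣)
open import Data.Vec using ([]; _∷_; here; there)
open import Data.Product using (_,_; proj₁; proj₂)
open import Data.Sum using (_⊎_; inj₁; inj₂)
open import Relation.Nullary using (¬_; yes; no; contradiction)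
open import Relation.Nullary.Decidable using (decidable-stable; ¬¬-excluded-middle)
open import Relation.Binary.PropositionalEquality as ≡ using (_≡_; _≢_; refl; cong; subst; subst₂)

private
  variable
    ℓ : Level
    n t : ℕ

module _ (P : ℕ → Set ℓ) where

  Least : ℕ → Set ℓ
  Least m = P m × (∀ k → P k → m ≤ k)

  Greatest : ℕ → Set ℓ
  Greatest m = P m × (∀ k → P k → k ≤ m)

¬¬-greatest : {P : ℕ → Set ℓ} (b : ℕ) {a : ℕ} →
              (∀ k → P k → k ≤ b) → P a → ¬ ¬ ∃ (Greatest P)
¬¬-greatest zero {a} bounded Pa done = done (a , Pa , λ k Pk → ≤-trans (bounded k Pk) z≤n)
¬¬-greatest {P = P} (suc b) bounded Pa done = ¬¬-excluded-middle {A = P (suc b)} λ where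
  (yes P[1+b]) → done (suc b , P[1+b] , bounded)
  (no ¬P[1+b]) → ¬¬-greatest b (λ k Pk → ≤-pred (≤∧≢⇒< (bounded k Pk) λ { refl → ¬P[1+b] Pk })) Pa done

-- The least element is the greatest lower bound, which satisfies P since
-- otherwise its successor would be a larger lower bound.
¬¬-least : {P : ℕ → Set ℓ} {b : ℕ} → P b → ¬ ¬ ∃ (Least P)
¬¬-least {P = P} {b} Pb done =
  ¬¬-greatest b (λ k below → below b Pb) (λ k _ → z≤n) λ (g , below-g , g-greatest) →
  ¬¬-excluded-middle {A = P g} λ where
    (yes Pg) → done (g , Pg , below-g)
    (no ¬Pg) → 1+n≰n (g-greatest (suc g) λ k Pk → ≤∧≢⇒< (below-g k Pk) λ { refl → ¬Pg Pk })

¬¬-maxSize : (Q : Subset n → Set) → Q ⊥ →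
             ¬ ¬ ∃ λ w → (Σ (Subset n) λ S → Q S × ∣ S ∣ ≡ w) × (∀ S → Q S → ∣ S ∣ ≤ w)
¬¬-maxSize {n} Q Q⊥ done =
  ¬¬-greatest n (λ { _ (S , _ , refl) → ∣p∣≤n S }) (⊥ , Q⊥ , ∣⊥∣≡0 n) λ (w , attained , maximal) →
  done (w , attained , λ S QS → maximal ∣ S ∣ (S , QS , refl))

trivialCover : (G : Graph n) → CliqueCover G n
trivialCover G = (λ v → v) , λ u v u≡v u≢v → contradiction u≡v u≢v

¬¬-alpha : (G : Graph n) → ¬ ¬ ∃ (IsAlpha G)
¬¬-alpha G = ¬¬-maxSize (IsStable G) λ u _ u∈⊥ → contradiction u∈⊥ ∉⊥

¬¬-omega : (G : Graph n) → ¬ ¬ ∃ (IsOmega G)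
¬¬-omega G = ¬¬-maxSize (IsClique G) λ u _ u∈⊥ → contradiction u∈⊥ ∉⊥

¬¬-theta : (G : Graph n) → ¬ ¬ ∃ (IsTheta G)
¬¬-theta G = ¬¬-least (trivialCover G)

enumerate : (p : Subset n) → Fin ∣ p ∣ → Fin n
enumerate (inside  ∷ p) zero    = zero
enumerate (inside  ∷ p) (suc i) = suc (enumerate p i)
enumerate (outside ∷ p) i       = suc (enumerate p i)

index : {x : Fin n} {p : Subset n} → x ∈ p → Fin ∣ p ∣
index {p = inside  ∷ p} here        = zero
index {p = inside  ∷ p} (there x∈p) = suc (index x∈p)
index {p = outside ∷ p} (there x∈p) = index x∈p

enumerate-index : {x : Fin n} {p : Subset n} (x∈p : x ∈ p) → enumerate p (index x∈p) ≡ x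
enumerate-index {p = inside  ∷ p} here        = refl
enumerate-index {p = inside  ∷ p} (there x∈p) = cong suc (enumerate-index x∈p)
enumerate-index {p = outside ∷ p} (there x∈p) = cong suc (enumerate-index x∈p)

index-injective : {x y : Fin n} {p : Subset n} (x∈p : x ∈ p) (y∈p : y ∈ p) →
                  index x∈p ≡ index y∈p → x ≡ y
index-injective {p = p} x∈p y∈p same = begin
  _                       ≡⟨ enumerate-index x∈p ⟨
  enumerate p (index x∈p) ≡⟨ cong (enumerate p) same ⟩
  enumerate p (index y∈p) ≡⟨ enumerate-index y∈p ⟩
  _                       ∎
  where open ≡.≡-Reasoning

image : (p : Subset n) → Subset ∣ p ∣ → Subset n
image []            q       = []
image (inside  ∷ p) (b ∷ q) = b ∷ image p q
image (outside ∷ p) q       = outside ∷ image p q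

∣image∣ : (p : Subset n) (q : Subset ∣ p ∣) → ∣ image p q ∣ ≡ ∣ q ∣
∣image∣ []            []            = refl
∣image∣ (inside  ∷ p) (inside  ∷ q) = cong suc (∣image∣ p q)
∣image∣ (inside  ∷ p) (outside ∷ q) = ∣image∣ p q
∣image∣ (outside ∷ p) q             = ∣image∣ p q

∈-image⁻ : {x : Fin n} (p : Subset n) (q : Subset ∣ p ∣) →
           x ∈ image p q → ∃ λ i → i ∈ q × enumerate p i ≡ x
∈-image⁻ (inside  ∷ p) (inside ∷ q) here        = zero , here , refl
∈-image⁻ (inside  ∷ p) (b      ∷ q) (there x∈)  with ∈-image⁻ p q x∈
... | i , i∈q , refl = suc i , there i∈q , refl
∈-image⁻ (outside ∷ p) q            (there x∈)  with ∈-image⁻ p q x∈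
... | i , i∈q , refl = i , i∈q , refl

induced : Graph n → (p : Subset n) → Graph ∣ p ∣
induced G p = record
  { E      = λ i j → E G (enumerate p i) (enumerate p j)
  ; sym    = sym G
  ; irrefl = irrefl G
  }

_∖_ : Graph n → (C : Subset n) → Graph ∣ ∁ C ∣
G ∖ C = induced G (∁ C)

image-isStable : (G : Graph n) (p : Subset n) {q : Subset ∣ p ∣} →
                 IsStable (induced G p) q → IsStable G (image p q)
image-isStable G p {q} q-stable x y x∈ y∈ with ∈-image⁻ p q x∈ | ∈-image⁻ p q y∈
... | i , i∈q , refl | j , j∈q , refl = q-stable i j i∈q j∈q

cover-∖-clique : (G : Graph n) {C : Subset n} {p : ℕ} →
                 IsClique G C → CliqueCover (G ∖ C) p → CliqueCover G (suc p)
cover-∖-clique {n} G {C} {p} C-clique (c , c-clique) = colour , colour-clique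
  where
  colour : Fin n → Fin (suc p)
  colour x with x ∈? C
  ... | yes _   = zero
  ... | no  x∉C = suc (c (index (x∉p⇒x∈∁p x∉C)))

  colour-clique : ∀ x y → colour x ≡ colour y → x ≢ y → E G x y
  colour-clique x y same x≢y with x ∈? C | y ∈? C
  ... | yes x∈C | yes y∈C = C-clique x y x∈C y∈C x≢y
  ... | no  x∉C | no  y∉C =
    subst₂ (E G) (enumerate-index x∈∁C) (enumerate-index y∈∁C)
      (c-clique _ _ (suc-injective same) λ i≡j → x≢y (index-injective x∈∁C y∈∁C i≡j))
    where
    x∈∁C = x∉p⇒x∈∁p x∉C
    y∈∁C = x∉p⇒x∈∁p y∉C

-- gap(G) ≥ t, stated without α(G) and θ(G), which exist only classically.
GapAtLeast : Graph n → ℕ → Set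
GapAtLeast G t = ∃ λ a → (∀ S → IsStable G S → ∣ S ∣ ≤ a)
                       × (∀ p → CliqueCover G p → a + t ≤ p)

hasGap⇒gapAtLeast : (G : Graph n) → HasGap G t → GapAtLeast G t
hasGap⇒gapAtLeast G (a , θ , (_ , α-maximal) , (_ , θ-minimal) , θ≡a+t) =
  a , α-maximal , λ p cover → subst (_≤ p) θ≡a+t (θ-minimal p cover)

gapAtLeast-∖-clique : (G : Graph n) {C : Subset n} → IsClique G C →
                      GapAtLeast G (suc t) → GapAtLeast (G ∖ C) t
gapAtLeast-∖-clique {t = t} G {C} C-clique (a , α≤a , a+1+t≤θ) =
  a , (λ q q-stable → subst (_≤ a) (∣image∣ (∁ C) q) (α≤a _ (image-isStable G (∁ C) q-stable)))
    , λ p cover → ≤-pred (subst (_≤ suc p) (+-suc a t) (a+1+t≤θ (suc p) (cover-∖-clique G C-clique cover)))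

⁅x⁆-isClique : (G : Graph n) (x : Fin n) → IsClique G ⁅ x ⁆
⁅x⁆-isClique G x y z y∈ z∈ y≢z = contradiction (≡.trans (x∈⁅y⁆⇒x≡y x y∈) (≡.sym (x∈⁅y⁆⇒x≡y x z∈))) y≢z

∣∁⁅x⁆∣<n : (x : Fin n) → ∣ ∁ ⁅ x ⁆ ∣ < n
∣∁⁅x⁆∣<n {suc n} x = begin-strict
  ∣ ∁ ⁅ x ⁆ ∣         ≡⟨ ∣∁p∣≡n∸∣p∣ ⁅ x ⁆ ⟩
  suc n ∸ ∣ ⁅ x ⁆ ∣   ≡⟨ cong (suc n ∸_) (∣⁅x⁆∣≡1 x) ⟩
  n                   <⟨ n<1+n n ⟩
  suc n               ∎
  where open ≤-Reasoning

gapAtLeast-shrink : (H : Graph n) → GapAtLeast H (suc t) →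
                    ∃ λ m → m < n × Σ (Graph m) λ H′ → GapAtLeast H′ t
gapAtLeast-shrink {zero}  {t} H (a , _ , a+1+t≤θ)
  with () ← subst (_≤ 0) (+-suc a t) (a+1+t≤θ 0 (trivialCover H))
gapAtLeast-shrink {suc n} H g =
  _ , ∣∁⁅x⁆∣<n zero , H ∖ ⁅ zero ⁆ , gapAtLeast-∖-clique H (⁅x⁆-isClique H zero) g

exactGap⊎gapAtLeast-suc : (H : Graph n) {α θ : ℕ} → IsAlpha H α → IsTheta H θ → α + t ≤ θ →
                          HasGap H t ⊎ GapAtLeast H (suc t)
exactGap⊎gapAtLeast-suc {t = t} H {α} {θ} isα isθ α+t≤θ with θ ≟ α + t
... | yes θ≡α+t = inj₁ (α , θ , isα , isθ , θ≡α+t)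
... | no  θ≢α+t = inj₂ (α , proj₂ isα , λ p cover →
        ≤-trans (subst (_≤ θ) (≡.sym (+-suc α t)) (≤∧≢⇒< α+t≤θ λ eq → θ≢α+t (≡.sym eq)))
                (proj₂ isθ p cover))

¬¬-exactGap⊎gapAtLeast-suc : (H : Graph n) → GapAtLeast H t →
                             ¬ ¬ (HasGap H t ⊎ GapAtLeast H (suc t))
¬¬-exactGap⊎gapAtLeast-suc {t = t} H (a , α≤a , a+t≤θ) done =
  ¬¬-alpha H λ (α , isα) → ¬¬-theta H λ (θ , isθ) →
  let (S , S-stable , ∣S∣≡α) = proj₁ isα
      α+t≤θ = ≤-trans (+-monoˡ-≤ t (subst (_≤ a) ∣S∣≡α (α≤a S S-stable))) (a+t≤θ θ (proj₁ isθ))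
  in done (exactGap⊎gapAtLeast-suc H isα isθ α+t≤θ)

gapAtLeast⇒s≤n : {s : ℕ} → IsS t s → (H : Graph n) → GapAtLeast H t → s ≤ n
gapAtLeast⇒s≤n {t} {n} {s} (_ , s-minimal) H g = decidable-stable (s ≤? n) λ s≰n →
  ¬¬-least {P = λ m → Σ (Graph m) λ H → GapAtLeast H t} (H , g) λ (m , (H₀ , g₀) , m-least) →
  ¬¬-exactGap⊎gapAtLeast-suc H₀ g₀ λ where
    (inj₁ gap) → s≰n (≤-trans (s-minimal m H₀ gap) (m-least n (H , g)))
    (inj₂ g₁)  → let (m′ , m′<m , H′ , g′) = gapAtLeast-shrink H₀ g₁
                 in <⇒≱ m′<m (m-least m′ (H′ , g′))

hasGap-suc⇒s+∣C∣≤n : {s : ℕ} → IsS t s → (G : Graph n) → HasGap G (suc t) →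
                     {C : Subset n} → IsClique G C → s + ∣ C ∣ ≤ n
hasGap-suc⇒s+∣C∣≤n {n = n} {s} isS G gap {C} C-clique = begin
  s + ∣ C ∣           ≤⟨ +-monoˡ-≤ ∣ C ∣ s≤∣∁C∣ ⟩
  ∣ ∁ C ∣ + ∣ C ∣     ≡⟨ cong (_+ ∣ C ∣) (∣∁p∣≡n∸∣p∣ C) ⟩
  n ∸ ∣ C ∣ + ∣ C ∣   ≡⟨ m∸n+n≡m (∣p∣≤n C) ⟩
  n                   ∎
  where
  open ≤-Reasoning
  s≤∣∁C∣ = gapAtLeast⇒s≤n isS (G ∖ C) (gapAtLeast-∖-clique G C-clique (hasGap⇒gapAtLeast G gap))

hasGap-suc⇒edge : (G : Graph n) → HasGap G (suc t) → ¬ (∀ u v → ¬ E G u v)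
hasGap-suc⇒edge {n} {t} G (a , θ , (_ , α-maximal) , (_ , θ-minimal) , θ≡a+1+t) edgeless =
  1+n≰n (begin
    suc a          ≤⟨ s≤s (m≤m+n a t) ⟩
    suc (a + t)    ≡⟨ +-suc a t ⟨
    a + suc t      ≡⟨ θ≡a+1+t ⟨
    θ              ≤⟨ θ-minimal n (trivialCover G) ⟩
    n              ≡⟨ ∣⊤∣≡n n ⟨
    ∣ ⊤ {n} ∣      ≤⟨ α-maximal ⊤ (λ u v _ _ → edgeless u v) ⟩
    a              ∎)
  where open ≤-Reasoning

edge-isClique : (G : Graph n) {u v : Fin n} → E G u v → IsClique G (⁅ u ⁆ ∪ ⁅ v ⁆)
edge-isClique G {u} {v} e x y x∈ y∈ x≢y with x∈p∪q⁻ ⁅ u ⁆ ⁅ v ⁆ x∈ | x∈p∪q⁻ ⁅ u ⁆ ⁅ v ⁆ y∈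
... | inj₁ x∈u | inj₂ y∈v rewrite x∈⁅y⁆⇒x≡y u x∈u | x∈⁅y⁆⇒x≡y v y∈v = e
... | inj₂ x∈v | inj₁ y∈u rewrite x∈⁅y⁆⇒x≡y v x∈v | x∈⁅y⁆⇒x≡y u y∈u = sym G e
... | inj₁ x∈u | inj₁ y∈u = contradiction (≡.trans (x∈⁅y⁆⇒x≡y u x∈u) (≡.sym (x∈⁅y⁆⇒x≡y u y∈u))) x≢y
... | inj₂ x∈v | inj₂ y∈v = contradiction (≡.trans (x∈⁅y⁆⇒x≡y v x∈v) (≡.sym (x∈⁅y⁆⇒x≡y v y∈v))) x≢y

2≤∣⁅x⁆∪⁅y⁆∣ : {x y : Fin n} → x ≢ y → 2 ≤ ∣ ⁅ x ⁆ ∪ ⁅ y ⁆ ∣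
2≤∣⁅x⁆∪⁅y⁆∣ {x = x} {y} x≢y = subst (_< ∣ ⁅ x ⁆ ∪ ⁅ y ⁆ ∣) (∣⁅x⁆∣≡1 x)
  (p⊂q⇒∣p∣<∣q∣ (p⊆p∪q ⁅ y ⁆ , y , q⊆p∪q ⁅ x ⁆ ⁅ y ⁆ (x∈⁅x⁆ y) , λ y∈x → x≢y (≡.sym (x∈⁅y⁆⇒x≡y x y∈x))))

hasGap-suc⇒2≤ω : (G : Graph n) → HasGap G (suc t) → {w : ℕ} → IsOmega G w → 2 ≤ w
hasGap-suc⇒2≤ω G gap {w} (_ , ω-maximal) = decidable-stable (2 ≤? w) λ 2≰w →
  hasGap-suc⇒edge G gap λ u v e →
    2≰w (≤-trans (2≤∣⁅x⁆∪⁅y⁆∣ {x = u} {v} λ { refl → irrefl G e }) (ω-maximal _ (edge-isClique G e)))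

proposition3p8 :
    ((t k s₀ s₁ : ℕ) → IsS t s₀ → IsS (suc t) s₁ →
      (Σ ℕ λ n → Σ (Graph n) λ G → IsExtremal (suc t) G × ∃ λ w → IsOmega G w × k ≤ w) →
      s₀ + k ≤ s₁)
    × ((t s₀ s₁ : ℕ) → IsS t s₀ → IsS (suc t) s₁ → s₀ + 2 ≤ s₁)
proposition3p8 = extremal-clique , extremal-edge
  where
  extremal-clique : (t k s₀ s₁ : ℕ) → IsS t s₀ → IsS (suc t) s₁ →
    (Σ ℕ λ n → Σ (Graph n) λ G → IsExtremal (suc t) G × ∃ λ w → IsOmega G w × k ≤ w) →
    s₀ + k ≤ s₁
  extremal-clique t k s₀ s₁ isS₀ ((G₁ , gap₁) , _)
                  (n , G , (gap , (_ , n-minimal)) , w , ((C , C-clique , ∣C∣≡w) , _) , k≤w) = begin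
    s₀ + k         ≤⟨ +-monoʳ-≤ s₀ (subst (k ≤_) (≡.sym ∣C∣≡w) k≤w) ⟩
    s₀ + ∣ C ∣     ≤⟨ hasGap-suc⇒s+∣C∣≤n isS₀ G gap C-clique ⟩
    n              ≤⟨ n-minimal s₁ G₁ gap₁ ⟩
    s₁             ∎
    where open ≤-Reasoning

  extremal-edge : (t s₀ s₁ : ℕ) → IsS t s₀ → IsS (suc t) s₁ → s₀ + 2 ≤ s₁
  extremal-edge t s₀ s₁ isS₀ isS₁@((G , gap) , _) = decidable-stable (s₀ + 2 ≤? s₁) λ ≰ →
    ¬¬-omega G λ (w , isω) →
    ≰ (extremal-clique t 2 s₀ s₁ isS₀ isS₁ (s₁ , G , (gap , isS₁) , w , isω , hasGap-suc⇒2≤ω G gap isω))
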